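{- Let $s\ge 2$, let $\alpha_1,\dots,\alpha_s$ be limit ordinals of finite degree written in Cantor normal form, let $p_1,\dots,p_s$ be nonzero natural numbers, and for each $i$ let $a_{n_i}\omega^{n_i}$ be the leading term of $\alpha_i$ (so $n_i=\deg(\alpha_i)$). Then $$\mathrm{D}\Big(\sum_{i=1}^s p_i\alpha_i\Big)\cong\sum_{i=1}^s\Big((p_i-1)a_{n_i}\omega^{n_i-1}+\mathrm{D}(\alpha_i)\Big).$$ If in addition each $\alpha_i$ has degree at least $2$, then both expressions are also isomorphic to $\sum_{i=1}^s p_i\,\mathrm{D}(\alpha_i)$.
   Context: Products of linear orders are lexicographic (each point of the left factor is replaced by a copy of the right factor), so $p\alpha=\alpha+\cdots+\alpha$ ($p$ copies) and $a\omega^n=\omega^n+\cdots+\omega^n$ ($a$ copies). Cantor normal form of an ordinal of finite degree: $a_n\omega^n+\cdots+a_1\omega+a_0$, $a_n\neq0$, degree $n$. Limit ordinals here are nonzero. For a linear order $L$, $x\sim_F y$ iff only finitely many points lie between $x$ and $y$, and $L/\!\sim_F$ is the ordered set of classes. $\mathrm{D}(\alpha)$ is the ordinal isomorphic to $\alpha/\!\sim_F$. -}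

module Defs where

open import Data.Nat using (ℕ; zero; suc; _≤_)
open import Data.Fin using (Fin; fromℕ; inject₁) renaming (_<_ to _<ᶠ_)
import Data.Fin as F
import Data.Nat as N
open import Data.Product using (Σ; _×_; _,_)
open import Data.Sum using (_⊎_; inj₁; inj₂)
open import Data.Empty using (⊥)
open import Data.Unit using (⊤)
open import Data.List using (List)
open import Data.List.Membership.Propositional using (_∈_)
open import Relation.Nullary using (¬_)
open import Relation.Binary.PropositionalEquality using (_≡_; _≢_)
open import Function using (_∘_)

-- A linear order given by a carrier and a strict order relation
-- (only concrete, genuinely linear instances are used below).
record LinOrd : Set₁ where
  field
    Carrier : Set
    _<_     : Carrier → Carrier → Set
open LinOrd public

-- An ordered set presented by a setoid (used for quotients such as L/∼F).
record SetoidOrd : Set₁ where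
  field
    SCarrier : Set
    _≈ₛ_     : SCarrier → SCarrier → Set
    _<ₛ_     : SCarrier → SCarrier → Set
open SetoidOrd public

toS : LinOrd → SetoidOrd
toS L = record { SCarrier = Carrier L ; _≈ₛ_ = _≡_ ; _<ₛ_ = _<_ L }

record _≅_ (A B : SetoidOrd) : Set where
  field
    to        : SCarrier A → SCarrier B
    from      : SCarrier B → SCarrier A
    to-cong   : ∀ {x y} → _≈ₛ_ A x y → _≈ₛ_ B (to x) (to y)
    to-inj    : ∀ {x y} → _≈ₛ_ B (to x) (to y) → _≈ₛ_ A x y
    to-from   : ∀ b → _≈ₛ_ B (to (from b)) b
    to-mono   : ∀ {x y} → _<ₛ_ A x y → _<ₛ_ B (to x) (to y)
    to-reflect : ∀ {x y} → _<ₛ_ B (to x) (to y) → _<ₛ_ A x y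

finOrd : ℕ → LinOrd
finOrd n = record { Carrier = Fin n ; _<_ = _<ᶠ_ }

natOrd : LinOrd
natOrd = record { Carrier = ℕ ; _<_ = N._<_ }

sumLt : (L M : LinOrd) → Carrier L ⊎ Carrier M → Carrier L ⊎ Carrier M → Set
sumLt L M (inj₁ a) (inj₁ b) = _<_ L a b
sumLt L M (inj₁ a) (inj₂ b) = ⊤
sumLt L M (inj₂ a) (inj₁ b) = ⊥
sumLt L M (inj₂ a) (inj₂ b) = _<_ M a b

_⊕_ : LinOrd → LinOrd → LinOrd
L ⊕ M = record { Carrier = Carrier L ⊎ Carrier M ; _<_ = sumLt L M }

-- Lexicographic product L · M: each point of L replaced by a copy of M
_⊗_ : LinOrd → LinOrd → LinOrd
L ⊗ M = record
  { Carrier = Carrier L × Carrier M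
  ; _<_ = λ { (a , b) (a' , b') → _<_ L a a' ⊎ (a ≡ a' × _<_ M b b') } }

⨁ : (s : ℕ) → (Fin s → LinOrd) → LinOrd
⨁ zero    F = finOrd 0
⨁ (suc s) F = F F.zero ⊕ ⨁ s (F ∘ F.suc)

scale : ℕ → LinOrd → LinOrd
scale p L = finOrd p ⊗ L

ωpow : ℕ → LinOrd
ωpow zero    = finOrd 1
ωpow (suc n) = natOrd ⊗ ωpow n

term : ℕ → ℕ → LinOrd
term a n = scale a (ωpow n)

-- Ordinals of finite degree in Cantor normal form a_n ω^n + ... + a_0,
-- coef k = a_k, a_n ≠ 0.
record CNF : Set where
  field
    deg  : ℕ
    coef : Fin (suc deg) → ℕ
    lead≢0 : coef (fromℕ deg) ≢ 0
open CNF public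

lead : CNF → ℕ
lead α = coef α (fromℕ (deg α))

cnfOrd : (n : ℕ) → (Fin (suc n) → ℕ) → LinOrd
cnfOrd zero    c = term (c F.zero) 0
cnfOrd (suc n) c = term (c (fromℕ (suc n))) (suc n) ⊕ cnfOrd n (c ∘ inject₁)

⟦_⟧ : CNF → LinOrd
⟦ α ⟧ = cnfOrd (deg α) (coef α)

-- limit ordinal (nonzero, no successor part)
IsLimit : CNF → Set
IsLimit α = (1 ≤ deg α) × (coef α F.zero ≡ 0)

-- x ∼F y : only finitely many points lie between x and y
Between : (L : LinOrd) → Carrier L → Carrier L → Carrier L → Set
Between L x y z = (_<_ L x z × _<_ L z y) ⊎ (_<_ L y z × _<_ L z x)

_∼F_ : {L : LinOrd} → Carrier L → Carrier L → Set
_∼F_ {L} x y = Σ (List (Carrier L)) λ l → ∀ z → Between L x y z → z ∈ l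

-- The condensation L/∼F, presented as a setoid order: classes [x] < [y]
-- iff x < y and x, y are not ∼F-equivalent.
cond : LinOrd → SetoidOrd
cond L = record
  { SCarrier = Carrier L
  ; _≈ₛ_ = _∼F_ {L}
  ; _<ₛ_ = λ x y → _<_ L x y × ¬ (_∼F_ {L} x y) }

-- Every limit ordinal of finite degree is α = β·ω, where β has the Cantor
-- normal form of α shifted down one degree; the same factorisation holds for
-- Σ pᵢαᵢ = (Σ pᵢβᵢ)·ω.  Condensing K·ω collapses each copy of ω to a point and
-- leaves K, so D(Σ pᵢαᵢ) ≅ Σ pᵢβᵢ and D(αᵢ) ≅ βᵢ.  Finally, writing βᵢ = T + γ
-- with T = aω^m its leading term, the lower part γ is absorbed by T
-- (γ + ω^m = ω^m), so (q+1)·βᵢ = T + γ + ⋯ + T + γ ≅ q·T + βᵢ.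
module Submission where

open import Defs
open import Data.Nat as ℕ using (ℕ; zero; suc; _+_; _∸_; _≤_; z≤n; s≤s)
import Data.Nat.Properties as ℕₚ
open import Data.Fin as Fin using (Fin; fromℕ; inject₁)
import Data.Fin.Properties as Finₚ
open import Data.Product using (Σ; _×_; _,_; proj₁; proj₂)
open import Data.Sum as Sum using (_⊎_; inj₁; inj₂)
open import Data.Empty using (⊥-elim)
open import Data.Unit using (tt)
open import Data.List using (map; applyUpTo)
open import Data.List.Membership.Propositional using (_∈_)
open import Data.List.Membership.Propositional.Properties using (∈-map⁺; ∈-applyUpTo⁺; finite)
open import Function using (_∘_)
open import Function.Bundles using (mk↣)
open import Relation.Nullary using (¬_)
open import Relation.Binary.Definitions using (Tri; tri<; tri≈; tri>)
open import Relation.Binary.PropositionalEquality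

infix 4 _≃_
record _≃_ (A B : LinOrd) : Set where
  field
    to         : Carrier A → Carrier B
    from       : Carrier B → Carrier A
    to-from    : ∀ b → to (from b) ≡ b
    from-to    : ∀ a → from (to a) ≡ a
    to-mono    : ∀ {x y} → _<_ A x y → _<_ B (to x) (to y)
    to-reflect : ∀ {x y} → _<_ B (to x) (to y) → _<_ A x y
open _≃_

≃-refl : ∀ {A} → A ≃ A
≃-refl = record
  { to = λ x → x ; from = λ x → x ; to-from = λ _ → refl ; from-to = λ _ → refl
  ; to-mono = λ p → p ; to-reflect = λ p → p }

≃-sym : ∀ {A B} → A ≃ B → B ≃ A
≃-sym {A} {B} I = record
  { to = from I ; from = to I ; to-from = from-to I ; from-to = to-from I
  ; to-mono = λ {x} {y} p → to-reflect I (subst₂ (_<_ B) (sym (to-from I x)) (sym (to-from I y)) p)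
  ; to-reflect = λ {x} {y} p → subst₂ (_<_ B) (to-from I x) (to-from I y) (to-mono I p) }

infixr 5 _∙_
_∙_ : ∀ {A B C} → A ≃ B → B ≃ C → A ≃ C
I ∙ J = record
  { to = to J ∘ to I ; from = from I ∘ from J
  ; to-from = λ c → trans (cong (to J) (to-from I (from J c))) (to-from J c)
  ; from-to = λ a → trans (cong (from I) (from-to J (to I a))) (from-to I a)
  ; to-mono = to-mono J ∘ to-mono I ; to-reflect = to-reflect I ∘ to-reflect J }

to-injective : ∀ {A B} (I : A ≃ B) {x y} → to I x ≡ to I y → x ≡ y
to-injective I {x} {y} e = trans (sym (from-to I x)) (trans (cong (from I) e) (from-to I y))

≃-empty : ∀ {A B} → ¬ Carrier A → ¬ Carrier B → A ≃ B
≃-empty ¬a ¬b = record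
  { to = ⊥-elim ∘ ¬a ; from = ⊥-elim ∘ ¬b ; to-from = ⊥-elim ∘ ¬b ; from-to = ⊥-elim ∘ ¬a
  ; to-mono = λ {x} → ⊥-elim (¬a x) ; to-reflect = λ {x} → ⊥-elim (¬a x) }

⊕-cong : ∀ {A A′ B B′} → A ≃ A′ → B ≃ B′ → A ⊕ B ≃ A′ ⊕ B′
⊕-cong {A} {A′} {B} {B′} I J = record
  { to = f ; from = Sum.map (from I) (from J)
  ; to-from = λ { (inj₁ a) → cong inj₁ (to-from I a) ; (inj₂ b) → cong inj₂ (to-from J b) }
  ; from-to = λ { (inj₁ a) → cong inj₁ (from-to I a) ; (inj₂ b) → cong inj₂ (from-to J b) }
  ; to-mono = λ {x} {y} → mono {x} {y} ; to-reflect = λ {x} {y} → reflect {x} {y} }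
  where
  f = Sum.map (to I) (to J)
  mono : ∀ {x y} → _<_ (A ⊕ B) x y → _<_ (A′ ⊕ B′) (f x) (f y)
  mono {inj₁ _} {inj₁ _} p = to-mono I p
  mono {inj₁ _} {inj₂ _} _ = tt
  mono {inj₂ _} {inj₂ _} p = to-mono J p
  reflect : ∀ {x y} → _<_ (A′ ⊕ B′) (f x) (f y) → _<_ (A ⊕ B) x y
  reflect {inj₁ _} {inj₁ _} p = to-reflect I p
  reflect {inj₁ _} {inj₂ _} _ = tt
  reflect {inj₂ _} {inj₂ _} p = to-reflect J p

⊕-assoc : ∀ {A B C} → (A ⊕ B) ⊕ C ≃ A ⊕ (B ⊕ C)
⊕-assoc {A} {B} {C} = record
  { to = f ; from = g
  ; to-from = λ { (inj₁ _) → refl ; (inj₂ (inj₁ _)) → refl ; (inj₂ (inj₂ _)) → refl }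
  ; from-to = λ { (inj₁ (inj₁ _)) → refl ; (inj₁ (inj₂ _)) → refl ; (inj₂ _) → refl }
  ; to-mono = λ {x} {y} → mono {x} {y} ; to-reflect = λ {x} {y} → reflect {x} {y} }
  where
  f : Carrier ((A ⊕ B) ⊕ C) → Carrier (A ⊕ (B ⊕ C))
  f (inj₁ (inj₁ a)) = inj₁ a
  f (inj₁ (inj₂ b)) = inj₂ (inj₁ b)
  f (inj₂ c)        = inj₂ (inj₂ c)
  g : Carrier (A ⊕ (B ⊕ C)) → Carrier ((A ⊕ B) ⊕ C)
  g (inj₁ a)        = inj₁ (inj₁ a)
  g (inj₂ (inj₁ b)) = inj₁ (inj₂ b)
  g (inj₂ (inj₂ c)) = inj₂ c
  mono : ∀ {x y} → _<_ ((A ⊕ B) ⊕ C) x y → _<_ (A ⊕ (B ⊕ C)) (f x) (f y)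
  mono {inj₁ (inj₁ _)} {inj₁ (inj₁ _)} p = p
  mono {inj₁ (inj₁ _)} {inj₁ (inj₂ _)} _ = tt
  mono {inj₁ (inj₂ _)} {inj₁ (inj₂ _)} p = p
  mono {inj₁ (inj₁ _)} {inj₂ _}        _ = tt
  mono {inj₁ (inj₂ _)} {inj₂ _}        _ = tt
  mono {inj₂ _}        {inj₂ _}        p = p
  reflect : ∀ {x y} → _<_ (A ⊕ (B ⊕ C)) (f x) (f y) → _<_ ((A ⊕ B) ⊕ C) x y
  reflect {inj₁ (inj₁ _)} {inj₁ (inj₁ _)} p = p
  reflect {inj₁ (inj₁ _)} {inj₁ (inj₂ _)} _ = tt
  reflect {inj₁ (inj₂ _)} {inj₁ (inj₂ _)} p = p
  reflect {inj₁ (inj₁ _)} {inj₂ _}        _ = tt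
  reflect {inj₁ (inj₂ _)} {inj₂ _}        _ = tt
  reflect {inj₂ _}        {inj₂ _}        p = p
  reflect {inj₁ (inj₂ _)} {inj₁ (inj₁ _)} ()
  reflect {inj₂ _}        {inj₁ (inj₁ _)} ()
  reflect {inj₂ _}        {inj₁ (inj₂ _)} ()

⊕-identityˡ : ∀ {E B} → ¬ Carrier E → E ⊕ B ≃ B
⊕-identityˡ {E} {B} ¬e = record
  { to = f ; from = inj₂
  ; to-from = λ _ → refl ; from-to = λ { (inj₁ e) → ⊥-elim (¬e e) ; (inj₂ _) → refl }
  ; to-mono = λ {x} {y} → mono {x} {y} ; to-reflect = λ {x} {y} → reflect {x} {y} }
  where
  f = Sum.[ ⊥-elim ∘ ¬e , (λ b → b) ]
  mono : ∀ {x y} → _<_ (E ⊕ B) x y → _<_ B (f x) (f y)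
  mono {inj₁ e} = ⊥-elim (¬e e)
  mono {inj₂ _} {inj₁ e} = ⊥-elim (¬e e)
  mono {inj₂ _} {inj₂ _} p = p
  reflect : ∀ {x y} → _<_ B (f x) (f y) → _<_ (E ⊕ B) x y
  reflect {inj₁ e} = ⊥-elim (¬e e)
  reflect {inj₂ _} {inj₁ e} = ⊥-elim (¬e e)
  reflect {inj₂ _} {inj₂ _} p = p

⊕-identityʳ : ∀ {A E} → ¬ Carrier E → A ⊕ E ≃ A
⊕-identityʳ {A} {E} ¬e = record
  { to = f ; from = inj₁
  ; to-from = λ _ → refl ; from-to = λ { (inj₁ _) → refl ; (inj₂ e) → ⊥-elim (¬e e) }
  ; to-mono = λ {x} {y} → mono {x} {y} ; to-reflect = λ {x} {y} → reflect {x} {y} }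
  where
  f = Sum.[ (λ a → a) , ⊥-elim ∘ ¬e ]
  mono : ∀ {x y} → _<_ (A ⊕ E) x y → _<_ A (f x) (f y)
  mono {inj₂ e} = ⊥-elim (¬e e)
  mono {inj₁ _} {inj₂ e} = ⊥-elim (¬e e)
  mono {inj₁ _} {inj₁ _} p = p
  reflect : ∀ {x y} → _<_ A (f x) (f y) → _<_ (A ⊕ E) x y
  reflect {inj₂ e} = ⊥-elim (¬e e)
  reflect {inj₁ _} {inj₂ e} = ⊥-elim (¬e e)
  reflect {inj₁ _} {inj₁ _} p = p

⊗-cong : ∀ {A A′ B B′} → A ≃ A′ → B ≃ B′ → A ⊗ B ≃ A′ ⊗ B′
⊗-cong I J = record
  { to = λ { (a , b) → to I a , to J b } ; from = λ { (a , b) → from I a , from J b }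
  ; to-from = λ { (a , b) → cong₂ _,_ (to-from I a) (to-from J b) }
  ; from-to = λ { (a , b) → cong₂ _,_ (from-to I a) (from-to J b) }
  ; to-mono = λ { (inj₁ p) → inj₁ (to-mono I p) ; (inj₂ (e , q)) → inj₂ (cong (to I) e , to-mono J q) }
  ; to-reflect = λ { (inj₁ p) → inj₁ (to-reflect I p) ; (inj₂ (e , q)) → inj₂ (to-injective I e , to-reflect J q) } }

⊗-congʳ : ∀ {A B B′} → B ≃ B′ → A ⊗ B ≃ A ⊗ B′
⊗-congʳ = ⊗-cong ≃-refl

⊗-assoc : ∀ {A B C} → (A ⊗ B) ⊗ C ≃ A ⊗ (B ⊗ C)
⊗-assoc {A} {B} {C} = record
  { to = λ { ((a , b) , c) → a , (b , c) } ; from = λ { (a , (b , c)) → (a , b) , c }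
  ; to-from = λ _ → refl ; from-to = λ _ → refl
  ; to-mono = λ { (inj₁ (inj₁ p)) → inj₁ p
                ; (inj₁ (inj₂ (e , q))) → inj₂ (e , inj₁ q)
                ; (inj₂ (refl , r)) → inj₂ (refl , inj₂ (refl , r)) }
  ; to-reflect = λ { (inj₁ p) → inj₁ (inj₁ p)
                   ; (inj₂ (e , inj₁ q)) → inj₁ (inj₂ (e , q))
                   ; (inj₂ (refl , inj₂ (refl , r))) → inj₂ (refl , r) } }

⊗-distribʳ-⊕ : ∀ {A B C} → (A ⊕ B) ⊗ C ≃ (A ⊗ C) ⊕ (B ⊗ C)
⊗-distribʳ-⊕ {A} {B} {C} = record
  { to = f ; from = g
  ; to-from = λ { (inj₁ _) → refl ; (inj₂ _) → refl }
  ; from-to = λ { (inj₁ _ , _) → refl ; (inj₂ _ , _) → refl }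
  ; to-mono = λ {x} {y} → mono {x} {y} ; to-reflect = λ {x} {y} → reflect {x} {y} }
  where
  f : Carrier ((A ⊕ B) ⊗ C) → Carrier ((A ⊗ C) ⊕ (B ⊗ C))
  f (inj₁ a , c) = inj₁ (a , c)
  f (inj₂ b , c) = inj₂ (b , c)
  g : Carrier ((A ⊗ C) ⊕ (B ⊗ C)) → Carrier ((A ⊕ B) ⊗ C)
  g (inj₁ (a , c)) = inj₁ a , c
  g (inj₂ (b , c)) = inj₂ b , c
  mono : ∀ {x y} → _<_ ((A ⊕ B) ⊗ C) x y → _<_ ((A ⊗ C) ⊕ (B ⊗ C)) (f x) (f y)
  mono {inj₁ _ , _} {inj₁ _ , _} (inj₁ p)          = inj₁ p
  mono {inj₁ _ , _} {inj₁ _ , _} (inj₂ (refl , q)) = inj₂ (refl , q)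
  mono {inj₁ _ , _} {inj₂ _ , _} _                 = tt
  mono {inj₂ _ , _} {inj₁ _ , _} (inj₁ ())
  mono {inj₂ _ , _} {inj₁ _ , _} (inj₂ (() , _))
  mono {inj₂ _ , _} {inj₂ _ , _} (inj₁ p)          = inj₁ p
  mono {inj₂ _ , _} {inj₂ _ , _} (inj₂ (refl , q)) = inj₂ (refl , q)
  reflect : ∀ {x y} → _<_ ((A ⊗ C) ⊕ (B ⊗ C)) (f x) (f y) → _<_ ((A ⊕ B) ⊗ C) x y
  reflect {inj₁ _ , _} {inj₁ _ , _} (inj₁ p)       = inj₁ p
  reflect {inj₁ _ , _} {inj₁ _ , _} (inj₂ (e , q)) = inj₂ (cong inj₁ e , q)
  reflect {inj₁ _ , _} {inj₂ _ , _} _              = inj₁ tt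
  reflect {inj₂ _ , _} {inj₂ _ , _} (inj₁ p)       = inj₁ p
  reflect {inj₂ _ , _} {inj₂ _ , _} (inj₂ (e , q)) = inj₂ (cong inj₂ e , q)

⊗-zeroˡ : ∀ {A B} → ¬ Carrier A → ¬ Carrier (A ⊗ B)
⊗-zeroˡ ¬a (a , _) = ¬a a

⊗-identityˡ : ∀ {L} → finOrd 1 ⊗ L ≃ L
⊗-identityˡ {L} = record
  { to = proj₂ ; from = Fin.zero ,_
  ; to-from = λ _ → refl ; from-to = λ { (Fin.zero , _) → refl }
  ; to-mono = λ {x} {y} → mono {x} {y} ; to-reflect = λ {x} {y} → reflect {x} {y} }
  where
  mono : ∀ {x y} → _<_ (finOrd 1 ⊗ L) x y → _<_ L (proj₂ x) (proj₂ y)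
  mono {Fin.zero , _} {Fin.zero , _} (inj₁ ())
  mono {Fin.zero , _} {Fin.zero , _} (inj₂ (_ , q)) = q
  reflect : ∀ {x y} → _<_ L (proj₂ x) (proj₂ y) → _<_ (finOrd 1 ⊗ L) x y
  reflect {Fin.zero , _} {Fin.zero , _} q = inj₂ (refl , q)

⊗-identityʳ : ∀ {L} → L ⊗ finOrd 1 ≃ L
⊗-identityʳ {L} = record
  { to = proj₁ ; from = _, Fin.zero
  ; to-from = λ _ → refl ; from-to = λ { (_ , Fin.zero) → refl }
  ; to-mono = λ {x} {y} → mono {x} {y} ; to-reflect = λ {x} {y} → reflect {x} {y} }
  where
  mono : ∀ {x y} → _<_ (L ⊗ finOrd 1) x y → _<_ L (proj₁ x) (proj₁ y)
  mono {_ , Fin.zero} {_ , Fin.zero} (inj₁ p) = p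
  mono {_ , Fin.zero} {_ , Fin.zero} (inj₂ (_ , ()))
  reflect : ∀ {x y} → _<_ L (proj₁ x) (proj₁ y) → _<_ (L ⊗ finOrd 1) x y
  reflect {_ , Fin.zero} {_ , Fin.zero} p = inj₁ p

finOrd-suc : ∀ {p} → finOrd (suc p) ≃ finOrd 1 ⊕ finOrd p
finOrd-suc {p} = record
  { to = f ; from = Sum.[ (λ _ → Fin.zero) , Fin.suc ]
  ; to-from = λ { (inj₁ Fin.zero) → refl ; (inj₂ _) → refl }
  ; from-to = λ { Fin.zero → refl ; (Fin.suc _) → refl }
  ; to-mono = λ {x} {y} → mono {x} {y} ; to-reflect = λ {x} {y} → reflect {x} {y} }
  where
  f : Fin (suc p) → Fin 1 ⊎ Fin p
  f Fin.zero    = inj₁ Fin.zero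
  f (Fin.suc i) = inj₂ i
  mono : ∀ {x y} → _<_ (finOrd (suc p)) x y → _<_ (finOrd 1 ⊕ finOrd p) (f x) (f y)
  mono {Fin.zero}  {Fin.suc _} _       = tt
  mono {Fin.suc _} {Fin.suc _} (s≤s q) = q
  reflect : ∀ {x y} → _<_ (finOrd 1 ⊕ finOrd p) (f x) (f y) → _<_ (finOrd (suc p)) x y
  reflect {Fin.zero}  {Fin.suc _} _ = s≤s z≤n
  reflect {Fin.suc _} {Fin.suc _} q = s≤s q

natOrd-unfold : natOrd ≃ finOrd 1 ⊕ natOrd
natOrd-unfold = record
  { to = f ; from = Sum.[ (λ _ → zero) , suc ]
  ; to-from = λ { (inj₁ Fin.zero) → refl ; (inj₂ _) → refl }
  ; from-to = λ { zero → refl ; (suc _) → refl }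
  ; to-mono = λ {x} {y} → mono {x} {y} ; to-reflect = λ {x} {y} → reflect {x} {y} }
  where
  f : ℕ → Fin 1 ⊎ ℕ
  f zero    = inj₁ Fin.zero
  f (suc n) = inj₂ n
  mono : ∀ {x y} → _<_ natOrd x y → _<_ (finOrd 1 ⊕ natOrd) (f x) (f y)
  mono {zero}  {suc _} _       = tt
  mono {suc _} {suc _} (s≤s q) = q
  reflect : ∀ {x y} → _<_ (finOrd 1 ⊕ natOrd) (f x) (f y) → _<_ natOrd x y
  reflect {zero}  {suc _} _ = s≤s z≤n
  reflect {suc _} {suc _} q = s≤s q

⊗-unfold : ∀ {A A′ L} → A ≃ finOrd 1 ⊕ A′ → A ⊗ L ≃ L ⊕ (A′ ⊗ L)
⊗-unfold I = ⊗-cong I ≃-refl ∙ ⊗-distribʳ-⊕ ∙ ⊕-cong ⊗-identityˡ ≃-refl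

scale-suc : ∀ {p L} → scale (suc p) L ≃ L ⊕ scale p L
scale-suc = ⊗-unfold finOrd-suc

natOrd⊗-unfold : ∀ {L} → natOrd ⊗ L ≃ L ⊕ (natOrd ⊗ L)
natOrd⊗-unfold = ⊗-unfold natOrd-unfold

scale-zero : ∀ {L} → ¬ Carrier (scale 0 L)
scale-zero {L} = ⊗-zeroˡ {finOrd 0} {L} λ ()

⨁-cong : ∀ s {F G : Fin s → LinOrd} → (∀ i → F i ≃ G i) → ⨁ s F ≃ ⨁ s G
⨁-cong zero    I = ≃-refl
⨁-cong (suc s) I = ⊕-cong (I Fin.zero) (⨁-cong s (I ∘ Fin.suc))

⨁-distribʳ-⊗ : ∀ s {F : Fin s → LinOrd} {C} → ⨁ s F ⊗ C ≃ ⨁ s (λ i → F i ⊗ C)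
⨁-distribʳ-⊗ zero {C = C} = ≃-empty (⊗-zeroˡ {finOrd 0} {C} λ ()) λ ()
⨁-distribʳ-⊗ (suc s) = ⊗-distribʳ-⊕ ∙ ⊕-cong ≃-refl (⨁-distribʳ-⊗ s)

ωpow-suc : ∀ k → ωpow (suc k) ≃ ωpow k ⊗ natOrd
ωpow-suc zero    = ⊗-identityʳ ∙ ≃-sym ⊗-identityˡ
ωpow-suc (suc k) = ⊗-congʳ (ωpow-suc k) ∙ ≃-sym ⊗-assoc

term-suc : ∀ a k → term a (suc k) ≃ term a k ⊗ natOrd
term-suc a k = ⊗-congʳ (ωpow-suc k) ∙ ≃-sym ⊗-assoc

term-zero : ∀ {a} k → a ≡ 0 → ¬ Carrier (term a k)
term-zero k refl = scale-zero {ωpow k}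

cnfOrd-limit : ∀ n (c : Fin (suc (suc n)) → ℕ) → c Fin.zero ≡ 0 →
               cnfOrd (suc n) c ≃ cnfOrd n (c ∘ Fin.suc) ⊗ natOrd
cnfOrd-limit zero    c c₀≡0 = ⊕-identityʳ (term-zero 0 c₀≡0) ∙ term-suc _ 0
cnfOrd-limit (suc n) c c₀≡0 =
  ⊕-cong (term-suc _ (suc n)) (cnfOrd-limit n (c ∘ inject₁) c₀≡0) ∙ ≃-sym ⊗-distribʳ-⊕

absorb-⊕ʳ : ∀ {A B C} → A ⊕ B ≃ B → A ⊕ (B ⊕ C) ≃ B ⊕ C
absorb-⊕ʳ I = ≃-sym ⊕-assoc ∙ ⊕-cong I ≃-refl

absorb-⊕ˡ : ∀ {A B C} → A ⊕ C ≃ C → B ⊕ C ≃ C → (A ⊕ B) ⊕ C ≃ C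
absorb-⊕ˡ I J = ⊕-assoc ∙ ⊕-cong ≃-refl J ∙ I

absorb-resp-≃ : ∀ {A B B′} → A ⊕ B ≃ B → B ≃ B′ → A ⊕ B′ ≃ B′
absorb-resp-≃ I J = ⊕-cong ≃-refl (≃-sym J) ∙ I ∙ J

absorb-natOrd⊗ : ∀ {A B} → A ⊕ B ≃ B → A ⊕ (natOrd ⊗ B) ≃ natOrd ⊗ B
absorb-natOrd⊗ I = absorb-resp-≃ (absorb-⊕ʳ I) (≃-sym natOrd⊗-unfold)

absorb-scale : ∀ {A B} → A ⊕ B ≃ B → ∀ a → scale a A ⊕ B ≃ B
absorb-scale {A} I zero    = ⊕-identityˡ (scale-zero {A})
absorb-scale I (suc a) = ⊕-cong scale-suc ≃-refl ∙ absorb-⊕ˡ I (absorb-scale I a)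

ωpow-absorb : ∀ {i k} → i ℕ.< k → ωpow i ⊕ ωpow k ≃ ωpow k
ωpow-absorb {i} {suc k} (s≤s i≤k) with ℕₚ.m≤n⇒m<n∨m≡n i≤k
... | inj₁ i<k  = absorb-natOrd⊗ (ωpow-absorb i<k)
... | inj₂ refl = ≃-sym natOrd⊗-unfold

cnfOrd-absorb : ∀ j (c : Fin (suc j) → ℕ) {k} → j ℕ.< k → cnfOrd j c ⊕ ωpow k ≃ ωpow k
cnfOrd-absorb zero    c j<k = absorb-scale (ωpow-absorb j<k) _
cnfOrd-absorb (suc j) c j<k =
  absorb-⊕ˡ (absorb-scale (ωpow-absorb j<k) _)
            (cnfOrd-absorb j (c ∘ inject₁) (ℕₚ.<-trans (ℕₚ.n<1+n j) j<k))

scale-suc-split : ∀ {β T γ} → β ≃ T ⊕ γ → γ ⊕ T ≃ T → ∀ q → scale (suc q) β ≃ scale q T ⊕ β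
scale-suc-split {β} {T} {γ} β≃T⊕γ γ⊕T≃T = go
  where
  starts-with-T : ∀ q → Σ LinOrd λ X → scale q T ⊕ β ≃ T ⊕ X
  starts-with-T zero    = γ , ⊕-identityˡ (scale-zero {T}) ∙ β≃T⊕γ
  starts-with-T (suc q) = scale q T ⊕ β , ⊕-cong scale-suc ≃-refl ∙ ⊕-assoc

  γ-absorbed : ∀ q → γ ⊕ (scale q T ⊕ β) ≃ scale q T ⊕ β
  γ-absorbed q = absorb-resp-≃ (absorb-⊕ʳ γ⊕T≃T) (≃-sym (proj₂ (starts-with-T q)))

  go : ∀ q → scale (suc q) β ≃ scale q T ⊕ β
  go zero    = scale-suc ∙ ⊕-identityʳ (scale-zero {β}) ∙ ≃-sym (⊕-identityˡ (scale-zero {T}))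
  go (suc q) = scale-suc ∙ ⊕-cong β≃T⊕γ (go q) ∙ ⊕-assoc ∙ ⊕-cong ≃-refl (γ-absorbed q)
             ∙ ≃-sym ⊕-assoc ∙ ⊕-cong (≃-sym scale-suc) ≃-refl

cnfOrd-split : ∀ m (c : Fin (suc m) → ℕ) →
               Σ LinOrd λ γ → cnfOrd m c ≃ term (c (fromℕ m)) m ⊕ γ × γ ⊕ ωpow m ≃ ωpow m
cnfOrd-split zero    c = finOrd 0 , ≃-sym (⊕-identityʳ λ ()) , ⊕-identityˡ λ ()
cnfOrd-split (suc m) c = cnfOrd m (c ∘ inject₁) , ≃-refl , cnfOrd-absorb m _ (ℕₚ.n<1+n m)

scale-cnfOrd : ∀ m (c : Fin (suc m) → ℕ) → c (fromℕ m) ≢ 0 →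
               ∀ q → scale (suc q) (cnfOrd m c) ≃ scale q (term (c (fromℕ m)) m) ⊕ cnfOrd m c
scale-cnfOrd m c lead≢0 with c (fromℕ m) | cnfOrd-split m c
... | zero  | _ = ⊥-elim (lead≢0 refl)
... | suc a | γ , split , γ⊕ω≃ω =
  scale-suc-split split (absorb-resp-≃ (absorb-⊕ʳ γ⊕ω≃ω) (≃-sym scale-suc))

record StrictTotal (L : LinOrd) : Set where
  field
    <-irrefl  : ∀ x → ¬ _<_ L x x
    <-trans   : ∀ {x y z} → _<_ L x y → _<_ L y z → _<_ L x z
    <-compare : ∀ x y → _<_ L x y ⊎ x ≡ y ⊎ _<_ L y x

fromTri : ∀ {A B C : Set} → Tri A B C → A ⊎ B ⊎ C
fromTri (tri< a _ _) = inj₁ a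
fromTri (tri≈ _ b _) = inj₂ (inj₁ b)
fromTri (tri> _ _ c) = inj₂ (inj₂ c)

finOrd-strictTotal : ∀ n → StrictTotal (finOrd n)
finOrd-strictTotal n = record
  { <-irrefl = λ _ → Finₚ.<-irrefl refl ; <-trans = Finₚ.<-trans
  ; <-compare = λ x y → fromTri (Finₚ.<-cmp x y) }

natOrd-strictTotal : StrictTotal natOrd
natOrd-strictTotal = record
  { <-irrefl = λ _ → ℕₚ.<-irrefl refl ; <-trans = ℕₚ.<-trans
  ; <-compare = λ x y → fromTri (ℕₚ.<-cmp x y) }

⊕-strictTotal : ∀ {A B} → StrictTotal A → StrictTotal B → StrictTotal (A ⊕ B)
⊕-strictTotal {A} {B} SA SB = record
  { <-irrefl = irrefl ; <-trans = λ {x} {y} {z} → trans< {x} {y} {z} ; <-compare = compare }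
  where
  module SA = StrictTotal SA
  module SB = StrictTotal SB
  irrefl : ∀ x → ¬ _<_ (A ⊕ B) x x
  irrefl (inj₁ a) = SA.<-irrefl a
  irrefl (inj₂ b) = SB.<-irrefl b
  trans< : ∀ {x y z} → _<_ (A ⊕ B) x y → _<_ (A ⊕ B) y z → _<_ (A ⊕ B) x z
  trans< {inj₁ _} {inj₁ _} {inj₁ _} p q = SA.<-trans p q
  trans< {inj₁ _} {_}      {inj₂ _} _ _ = tt
  trans< {inj₂ _} {inj₂ _} {inj₂ _} p q = SB.<-trans p q
  compare : ∀ x y → _<_ (A ⊕ B) x y ⊎ x ≡ y ⊎ _<_ (A ⊕ B) y x
  compare (inj₁ a) (inj₁ a′) = Sum.map₂ (Sum.map₁ (cong inj₁)) (SA.<-compare a a′)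
  compare (inj₁ _) (inj₂ _)  = inj₁ tt
  compare (inj₂ _) (inj₁ _)  = inj₂ (inj₂ tt)
  compare (inj₂ b) (inj₂ b′) = Sum.map₂ (Sum.map₁ (cong inj₂)) (SB.<-compare b b′)

⊗-strictTotal : ∀ {A B} → StrictTotal A → StrictTotal B → StrictTotal (A ⊗ B)
⊗-strictTotal {A} {B} SA SB = record
  { <-irrefl = irrefl ; <-trans = trans< ; <-compare = compare }
  where
  module SA = StrictTotal SA
  module SB = StrictTotal SB
  irrefl : ∀ x → ¬ _<_ (A ⊗ B) x x
  irrefl (a , _) (inj₁ p)       = SA.<-irrefl a p
  irrefl (_ , b) (inj₂ (_ , q)) = SB.<-irrefl b q
  trans< : ∀ {x y z} → _<_ (A ⊗ B) x y → _<_ (A ⊗ B) y z → _<_ (A ⊗ B) x z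
  trans< (inj₁ p)          (inj₁ q)          = inj₁ (SA.<-trans p q)
  trans< (inj₁ p)          (inj₂ (refl , _)) = inj₁ p
  trans< (inj₂ (refl , _)) (inj₁ q)          = inj₁ q
  trans< (inj₂ (refl , p)) (inj₂ (refl , q)) = inj₂ (refl , SB.<-trans p q)
  compare : ∀ x y → _<_ (A ⊗ B) x y ⊎ x ≡ y ⊎ _<_ (A ⊗ B) y x
  compare (a , b) (a′ , b′) with SA.<-compare a a′
  ... | inj₁ p           = inj₁ (inj₁ p)
  ... | inj₂ (inj₂ p)    = inj₂ (inj₂ (inj₁ p))
  ... | inj₂ (inj₁ refl) with SB.<-compare b b′
  ...   | inj₁ q           = inj₁ (inj₂ (refl , q))
  ...   | inj₂ (inj₁ refl) = inj₂ (inj₁ refl)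
  ...   | inj₂ (inj₂ q)    = inj₂ (inj₂ (inj₂ (refl , q)))

⨁-strictTotal : ∀ s {F : Fin s → LinOrd} → (∀ i → StrictTotal (F i)) → StrictTotal (⨁ s F)
⨁-strictTotal zero    _ = finOrd-strictTotal 0
⨁-strictTotal (suc s) S = ⊕-strictTotal (S Fin.zero) (⨁-strictTotal s (S ∘ Fin.suc))

ωpow-strictTotal : ∀ k → StrictTotal (ωpow k)
ωpow-strictTotal zero    = finOrd-strictTotal 1
ωpow-strictTotal (suc k) = ⊗-strictTotal natOrd-strictTotal (ωpow-strictTotal k)

cnfOrd-strictTotal : ∀ n c → StrictTotal (cnfOrd n c)
cnfOrd-strictTotal zero    c = ⊗-strictTotal (finOrd-strictTotal _) (ωpow-strictTotal 0)
cnfOrd-strictTotal (suc n) c =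
  ⊕-strictTotal (⊗-strictTotal (finOrd-strictTotal _) (ωpow-strictTotal (suc n))) (cnfOrd-strictTotal n _)

∼F-sym : ∀ {L x y} → _∼F_ {L} x y → _∼F_ {L} y x
∼F-sym (xs , covers) = xs , λ z → covers z ∘ Sum.swap

module _ {K : LinOrd} (S : StrictTotal K) where
  open StrictTotal S

  private
    L = K ⊗ natOrd

  ≁F-across : ∀ {k n k′ n′} → _<_ K k k′ → ¬ _∼F_ {L} (k , n) (k′ , n′)
  ≁F-across {k} {n} k<k′ (xs , covers) =
    finite (mk↣ {to = λ m → k , suc n + m} injective) xs
      (λ m → covers _ (inj₁ (inj₂ (refl , s≤s (ℕₚ.m≤m+n n m)) , inj₁ k<k′)))
    where
    injective : ∀ {m m′} → (k , suc n + m) ≡ (k , suc n + m′) → m ≡ m′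
    injective e = ℕₚ.+-cancelˡ-≡ (suc n) _ _ (cong proj₂ e)

  between-fibre : ∀ {k n n′ N z} → n′ ≤ N → _<_ L (k , n) z → _<_ L z (k , n′) →
                  z ∈ applyUpTo (k ,_) N
  between-fibre _ (inj₁ k<k″)       (inj₁ k″<k)       = ⊥-elim (<-irrefl _ (<-trans k<k″ k″<k))
  between-fibre _ (inj₁ k<k)        (inj₂ (refl , _)) = ⊥-elim (<-irrefl _ k<k)
  between-fibre _ (inj₂ (refl , _)) (inj₁ k<k)        = ⊥-elim (<-irrefl _ k<k)
  between-fibre n′≤N (inj₂ (refl , _)) (inj₂ (_ , m<n′)) =
    ∈-applyUpTo⁺ (_ ,_) (ℕₚ.<-≤-trans m<n′ n′≤N)

  ∼F⇒≡ : ∀ {x y} → _∼F_ {L} x y → proj₁ x ≡ proj₁ y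
  ∼F⇒≡ {k , _} {k′ , _} x∼y with <-compare k k′
  ... | inj₁ k<k′        = ⊥-elim (≁F-across k<k′ x∼y)
  ... | inj₂ (inj₁ k≡k′) = k≡k′
  ... | inj₂ (inj₂ k′<k) = ⊥-elim (≁F-across k′<k (∼F-sym {L} x∼y))

  ≡⇒∼F : ∀ {x y} → proj₁ x ≡ proj₁ y → _∼F_ {L} x y
  ≡⇒∼F {k , n} {_ , n′} refl = applyUpTo (k ,_) (n + n′) , covers
    where
    covers : ∀ z → Between L (k , n) (k , n′) z → z ∈ applyUpTo (k ,_) (n + n′)
    covers _ (inj₁ (p , q)) = between-fibre (ℕₚ.m≤n+m n′ n) p q
    covers _ (inj₂ (p , q)) = between-fibre (ℕₚ.m≤m+n n n′) p q

  cond-⊗natOrd : cond (K ⊗ natOrd) ≅ toS K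
  cond-⊗natOrd = record
    { to = proj₁ ; from = _, 0 ; to-cong = ∼F⇒≡ ; to-inj = ≡⇒∼F ; to-from = λ _ → refl
    ; to-mono = λ { (inj₁ k<k′ , _) → k<k′ ; (inj₂ (k≡k′ , _) , x≁y) → ⊥-elim (x≁y (≡⇒∼F k≡k′)) }
    ; to-reflect = λ k<k′ → inj₁ k<k′ , ≁F-across k<k′ }

module _ {L M : LinOrd} (I : L ≃ M) where

  ∼F-image : ∀ {x y} → _∼F_ {L} x y → _∼F_ {M} (to I x) (to I y)
  ∼F-image (xs , covers) = map (to I) xs , λ z btw →
    subst (_∈ map (to I) xs) (to-from I z) (∈-map⁺ (to I) (covers _ (preimage btw)))
    where
    reflect′ : ∀ {x z} → _<_ M (to I x) z → _<_ L x (from I z)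
    reflect′ {z = z} p = to-reflect I (subst (_<_ M _) (sym (to-from I z)) p)
    reflect″ : ∀ {z y} → _<_ M z (to I y) → _<_ L (from I z) y
    reflect″ {z} p = to-reflect I (subst (λ w → _<_ M w _) (sym (to-from I z)) p)
    preimage : ∀ {x y z} → Between M (to I x) (to I y) z → Between L x y (from I z)
    preimage = Sum.map (λ { (p , q) → reflect′ p , reflect″ q }) (λ { (p , q) → reflect′ p , reflect″ q })

  ∼F-preimage : ∀ {x y} → _∼F_ {M} (to I x) (to I y) → _∼F_ {L} x y
  ∼F-preimage (xs , covers) = map (from I) xs , λ z btw →
    subst (_∈ map (from I) xs) (from-to I z) (∈-map⁺ (from I) (covers _ (image btw)))
    where
    image : ∀ {x y z} → Between L x y z → Between M (to I x) (to I y) (to I z)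
    image = Sum.map (λ { (p , q) → to-mono I p , to-mono I q }) (λ { (p , q) → to-mono I p , to-mono I q })

  cond-resp-≃ : ∀ {K} → cond M ≅ toS K → cond L ≅ toS K
  cond-resp-≃ J = record
    { to = J.to ∘ to I ; from = from I ∘ J.from
    ; to-cong = J.to-cong ∘ ∼F-image ; to-inj = ∼F-preimage ∘ J.to-inj
    ; to-from = λ k → trans (cong J.to (to-from I (J.from k))) (J.to-from k)
    ; to-mono = λ { (p , x≁y) → J.to-mono (to-mono I p , x≁y ∘ ∼F-preimage) }
    ; to-reflect = λ p → let (q , x≁y) = J.to-reflect p in to-reflect I q , x≁y ∘ ∼F-image }
    where module J = _≅_ J

≅-resp-≃ : ∀ {A B C} → A ≅ toS B → B ≃ C → A ≅ toS C
≅-resp-≃ X I = record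
  { to = to I ∘ X.to ; from = X.from ∘ from I
  ; to-cong = cong (to I) ∘ X.to-cong ; to-inj = X.to-inj ∘ to-injective I
  ; to-from = λ c → trans (cong (to I) (X.to-from (from I c))) (to-from I c)
  ; to-mono = to-mono I ∘ X.to-mono ; to-reflect = X.to-reflect ∘ to-reflect I }
  where module X = _≅_ X

≅-unique : ∀ {A B C} → A ≅ toS B → A ≅ toS C → B ≃ C
≅-unique {A} {B} X Y = record
  { to = Y.to ∘ X.from ; from = X.to ∘ Y.from
  ; to-from = λ c → trans (Y.to-cong (X.to-inj (X.to-from (X.to (Y.from c))))) (Y.to-from c)
  ; from-to = λ b → trans (X.to-cong (Y.to-inj (Y.to-from (Y.to (X.from b))))) (X.to-from b)
  ; to-mono = λ {b} {b′} p →
      Y.to-mono (X.to-reflect (subst₂ (_<_ B) (sym (X.to-from b)) (sym (X.to-from b′)) p))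
  ; to-reflect = λ {b} {b′} p → subst₂ (_<_ B) (X.to-from b) (X.to-from b′) (X.to-mono (Y.to-reflect p)) }
  where
  module X = _≅_ X
  module Y = _≅_ Y

≃⇒≅ : ∀ {A B} → A ≃ B → toS A ≅ toS B
≃⇒≅ I = record
  { to = to I ; from = from I ; to-cong = cong (to I) ; to-inj = to-injective I
  ; to-from = to-from I ; to-mono = to-mono I ; to-reflect = to-reflect I }

record LimitDecomposition (α : CNF) : Set₁ where
  field
    base             : LinOrd
    base-strictTotal : StrictTotal base
    ⟦⟧≃base⊗natOrd   : ⟦ α ⟧ ≃ base ⊗ natOrd
    scale-suc-base   : ∀ q → scale (suc q) base ≃ scale q (term (lead α) (deg α ∸ 1)) ⊕ base

  cond≅base : cond ⟦ α ⟧ ≅ toS base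
  cond≅base = cond-resp-≃ ⟦⟧≃base⊗natOrd (cond-⊗natOrd base-strictTotal)

limitDecomposition : ∀ α → IsLimit α → LimitDecomposition α
limitDecomposition record { deg = zero } (() , _)
limitDecomposition record { deg = suc m ; coef = c ; lead≢0 = lead≢0 } (_ , c₀≡0) = record
  { base             = cnfOrd m (c ∘ Fin.suc)
  ; base-strictTotal = cnfOrd-strictTotal m _
  ; ⟦⟧≃base⊗natOrd   = cnfOrd-limit m c c₀≡0
  ; scale-suc-base   = scale-cnfOrd m (c ∘ Fin.suc) lead≢0 }

cond-⨁-scale-⊗natOrd : ∀ s (p : Fin s → ℕ) {β : Fin s → LinOrd} → (∀ i → StrictTotal (β i)) →
  cond (⨁ s (λ i → scale (p i) (β i ⊗ natOrd))) ≅ toS (⨁ s (λ i → scale (p i) (β i)))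
cond-⨁-scale-⊗natOrd s p S =
  cond-resp-≃ (⨁-cong s (λ _ → ≃-sym ⊗-assoc) ∙ ≃-sym (⨁-distribʳ-⊗ s))
    (cond-⊗natOrd (⨁-strictTotal s (λ i → ⊗-strictTotal (finOrd-strictTotal (p i)) (S i))))

mainTheorem3 : (s : ℕ) → 2 ≤ s →
    (α : Fin s → CNF) → (∀ i → IsLimit (α i)) →
    (p : Fin s → ℕ) → (∀ i → p i ≢ 0) →
    (δ : Fin s → LinOrd) → (∀ i → cond ⟦ α i ⟧ ≅ toS (δ i)) →
    (cond (⨁ s (λ i → scale (p i) ⟦ α i ⟧))
       ≅ toS (⨁ s (λ i → scale (p i ∸ 1) (term (lead (α i)) (deg (α i) ∸ 1)) ⊕ δ i)))
    × ((∀ i → 2 ≤ deg (α i)) →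
        (cond (⨁ s (λ i → scale (p i) ⟦ α i ⟧)) ≅ toS (⨁ s (λ i → scale (p i) (δ i))))
        × (toS (⨁ s (λ i → scale (p i ∸ 1) (term (lead (α i)) (deg (α i) ∸ 1)) ⊕ δ i))
             ≅ toS (⨁ s (λ i → scale (p i) (δ i)))))
mainTheorem3 s _ α limit p p≢0 δ cond≅δ =
  ≅-resp-≃ cond≅⨁pδ ⨁pδ≃⨁split , λ _ → cond≅⨁pδ , ≃⇒≅ (≃-sym ⨁pδ≃⨁split)
  where
  module A (i : Fin s) = LimitDecomposition (limitDecomposition (α i) (limit i))

  base≃δ : ∀ i → A.base i ≃ δ i
  base≃δ i = ≅-unique (A.cond≅base i) (cond≅δ i)

  cond≅⨁pδ : cond (⨁ s (λ i → scale (p i) ⟦ α i ⟧)) ≅ toS (⨁ s (λ i → scale (p i) (δ i)))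
  cond≅⨁pδ = ≅-resp-≃
    (cond-resp-≃ (⨁-cong s (⊗-congʳ ∘ A.⟦⟧≃base⊗natOrd)) (cond-⨁-scale-⊗natOrd s p A.base-strictTotal))
    (⨁-cong s (⊗-congʳ ∘ base≃δ))

  scale-δ : ∀ i → scale (p i) (δ i) ≃ scale (p i ∸ 1) (term (lead (α i)) (deg (α i) ∸ 1)) ⊕ δ i
  scale-δ i with p i | p≢0 i
  ... | zero  | p≢0 = ⊥-elim (p≢0 refl)
  ... | suc q | _   = ⊗-congʳ (≃-sym (base≃δ i)) ∙ A.scale-suc-base i q ∙ ⊕-cong ≃-refl (base≃δ i)

  ⨁pδ≃⨁split : ⨁ s (λ i → scale (p i) (δ i))
             ≃ ⨁ s (λ i → scale (p i ∸ 1) (term (lead (α i)) (deg (α i) ∸ 1)) ⊕ δ i)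
  ⨁pδ≃⨁split = ⨁-cong s scale-δ
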